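{- Let $V$ be a word with $u$ letters $\uparrow$ and $d$ letters $\downarrow$ (in any order), and let $H$ be a word with $r$ letters $\rightarrow$ and $l$ letters $\leftarrow$ (in any order). Then for every integer $k$, the number of shuffles of $V$ and $H$ with signed peak-count equal to $k$ is $$\binom{r+u}{u-k}\binom{l+d}{d+k}.$$
   Context: A shuffle of $V$ and $H$ is a word of length $|V|+|H|$ obtained by interleaving the letters of $V$ and $H$, preserving the order of letters within $V$ and within $H$; there are $\binom{|V|+|H|}{|H|}$ of them (shuffles are counted as distinct interleavings). The signed peak-count of a shuffle $\sigma$ is the number of occurrences of $\uparrow$ immediately followed by $\leftarrow$ in $\sigma$ minus the number of occurrences of $\rightarrow$ immediately followed by $\downarrow$ in $\sigma$. Binomial coefficients $\binom{a}{b}$ are $0$ unless $0\le b\le a$. -}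

module Defs where

open import Data.Nat using (ℕ; zero; suc; _+_)
open import Data.Nat.Combinatorics using (_C_)
open import Data.Integer using (ℤ; +_; -[1+_]; _-_)
open import Data.List using (List; []; _∷_; map; _++_; length; filter)
open import Relation.Binary.PropositionalEquality using (_≡_)
open import Relation.Nullary using (Dec; yes; no)

data Letter : Set where
  up down right left : Letter

data VLetter : Set where
  ↑ ↓ : VLetter

data HLetter : Set where
  ⟶ ⟵ : HLetter

vl : VLetter → Letter
vl ↑ = up
vl ↓ = down

hl : HLetter → Letter
hl ⟶ = right
hl ⟵ = left

countV : VLetter → List VLetter → ℕ
countV a [] = 0
countV ↑ (↑ ∷ w) = suc (countV ↑ w)
countV ↑ (↓ ∷ w) = countV ↑ w
countV ↓ (↑ ∷ w) = countV ↓ w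
countV ↓ (↓ ∷ w) = suc (countV ↓ w)

countH : HLetter → List HLetter → ℕ
countH a [] = 0
countH ⟶ (⟶ ∷ w) = suc (countH ⟶ w)
countH ⟶ (⟵ ∷ w) = countH ⟶ w
countH ⟵ (⟶ ∷ w) = countH ⟵ w
countH ⟵ (⟵ ∷ w) = suc (countH ⟵ w)

-- All shuffles (interleavings) of V and H, as a list with multiplicity:
-- one entry per interleaving (choice of positions), so there are
-- binom(|V|+|H|, |H|) entries.
shuffles : List VLetter → List HLetter → List (List Letter)
shuffles [] h = map hl h ∷ []
shuffles (a ∷ v) [] = map vl (a ∷ v) ∷ []
shuffles (a ∷ v) (b ∷ h) =
  map (vl a ∷_) (shuffles v (b ∷ h)) ++ map (hl b ∷_) (shuffles (a ∷ v) h)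

#upLeft : List Letter → ℕ
#upLeft [] = 0
#upLeft (up ∷ left ∷ w) = suc (#upLeft (left ∷ w))
#upLeft (_ ∷ w) = #upLeft w

#rightDown : List Letter → ℕ
#rightDown [] = 0
#rightDown (right ∷ down ∷ w) = suc (#rightDown (down ∷ w))
#rightDown (_ ∷ w) = #rightDown w

peak : List Letter → ℤ
peak w = + #upLeft w - + #rightDown w

countPeak : ℤ → List (List Letter) → ℕ
countPeak k [] = 0
countPeak k (w ∷ ws) with peak w Data.Integer.≟ k
... | yes _ = suc (countPeak k ws)
... | no _ = countPeak k ws

-- binomial coefficient with integer lower index: 0 if b < 0 (and, via _C_, 0 if b > a)
binomℤ : ℕ → ℤ → ℕ
binomℤ a (+ b) = a C b
binomℤ a -[1+ _ ] = 0

module Submission where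

-- The claimed value is closedForm u d r l k = G u r (-k) · G d l k, where
-- G d l k = C(l+d, d+k).  Both sides are compared by induction on V and H,
-- splitting on the pair (first letter of V, first letter of H).
--
-- First, Pascal's rule for G (in d, in l, and in both) yields one recurrence
-- for the closed form per pair of first letters.  Second, a shuffle of a∷v
-- and b∷h starts with a or with b, and a leading letter x changes the peak
-- count of x∷w only if x∷w starts with ↑← (by +1) or →↓ (by -1); following
-- these two patterns gives the same four recurrences for N.  If V or H is
-- empty there is a single shuffle without peaks, matching the closed form.
-- In the cases ↑/← and ↓/→ the recurrences contain the smaller term N v h on
-- both sides, which is cancelled.

open import Defs
open import Data.Nat using (ℕ; _*_) renaming (_+_ to _+ℕ_)
open import Data.Integer using (ℤ; +_; _-_; _+_)
open import Data.List using (List)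
open import Relation.Binary.PropositionalEquality using (_≡_)

open import Data.Nat using (zero; suc; s≤s; z≤n)
open import Data.Nat.Properties
  using (+-suc; +-comm; +-identityʳ; +-cancelʳ-≡; *-zeroʳ;
         *-distribˡ-+; *-distribʳ-+; m<m+n; +-commutativeSemigroup)
open import Algebra.Properties.CommutativeSemigroup +-commutativeSemigroup
  using (xy∙z≈xz∙y; xy∙z≈zy∙x; xy∙z≈yz∙x)
open import Data.Nat.Combinatorics
  using (_C_; nCk+nC[k+1]≡[n+1]C[k+1]; nCn≡1; k>n⇒nCk≡0)
open import Data.Integer using (-_; 0ℤ; 1ℤ; -1ℤ; +[1+_]; -[1+_]; _≟_)
import Data.Integer.Properties as ℤ
open import Algebra.Properties.AbelianGroup ℤ.+-0-abelianGroup
  using () renaming (∙-cancelʳ to +-cancelʳ-ℤ)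
open import Data.Integer.Tactic.RingSolver using (solve-∀)
import Data.Nat.Tactic.RingSolver as ℕ-Solver
open import Data.List using ([]; _∷_; map; _++_)
open import Data.List.Properties using (map-++)
open import Data.List.Relation.Unary.All using (All; []; _∷_; universal)
import Data.List.Relation.Unary.All as All
open import Data.List.Relation.Unary.All.Properties using (map⁺; ++⁺)
open import Relation.Binary.PropositionalEquality
  using (refl; sym; trans; cong; cong₂; subst; module ≡-Reasoning)
open import Relation.Nullary using (yes; no)
open import Data.Empty using (⊥-elim)

open ≡-Reasoning

+suc-+ : ∀ d k → + suc d + k ≡ (+ d + k) + 1ℤ
+suc-+ d k = shift (+ d) k
  where
  shift : ∀ a k → (1ℤ + a) + k ≡ (a + k) + 1ℤ
  shift = solve-∀

pred-+1 : ∀ k → (k - 1ℤ) + 1ℤ ≡ k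
pred-+1 = solve-∀

suc-+-1 : ∀ k → (k + 1ℤ) + -1ℤ ≡ k
suc-+-1 = solve-∀

binomℤ-pascal : ∀ n z → binomℤ (suc n) (z + 1ℤ) ≡ binomℤ n z +ℕ binomℤ n (z + 1ℤ)
binomℤ-pascal n (+ j) rewrite +-comm j 1 = sym (nCk+nC[k+1]≡[n+1]C[k+1] n j)
binomℤ-pascal n -[1+ zero ] = refl
binomℤ-pascal n -[1+ suc j ] = refl

binomℤ-pascal-at : ∀ {m w} n z → m ≡ suc n → w ≡ z + 1ℤ →
  binomℤ m w ≡ binomℤ n z +ℕ binomℤ n (z + 1ℤ)
binomℤ-pascal-at n z refl refl = binomℤ-pascal n z

G : ℕ → ℕ → ℤ → ℕ
G d l k = binomℤ (l +ℕ d) (+ d + k)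

closedForm : ℕ → ℕ → ℕ → ℕ → ℤ → ℕ
closedForm u d r l k = G u r (- k) * G d l k

G-sucᵈ : ∀ d l k → G (suc d) l k ≡ G d l k +ℕ G d l (k + 1ℤ)
G-sucᵈ d l k = begin
  G (suc d) l k
    ≡⟨ binomℤ-pascal-at (l +ℕ d) (+ d + k) (+-suc l d) (+suc-+ d k) ⟩
  G d l k +ℕ binomℤ (l +ℕ d) ((+ d + k) + 1ℤ)
    ≡⟨ cong (λ z → G d l k +ℕ binomℤ (l +ℕ d) z) (ℤ.+-assoc (+ d) k 1ℤ) ⟩
  G d l k +ℕ G d l (k + 1ℤ)
    ∎

G-sucˡ : ∀ d l k → G d (suc l) k ≡ G d l k +ℕ G d l (k - 1ℤ)
G-sucˡ d l k = begin
  G d (suc l) k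
    ≡⟨ binomℤ-pascal-at (l +ℕ d) (+ d + (k - 1ℤ)) refl (lower-shift (+ d) k) ⟩
  G d l (k - 1ℤ) +ℕ binomℤ (l +ℕ d) ((+ d + (k - 1ℤ)) + 1ℤ)
    ≡⟨ cong (λ z → G d l (k - 1ℤ) +ℕ binomℤ (l +ℕ d) z) (sym (lower-shift (+ d) k)) ⟩
  G d l (k - 1ℤ) +ℕ G d l k
    ≡⟨ +-comm (G d l (k - 1ℤ)) _ ⟩
  G d l k +ℕ G d l (k - 1ℤ)
    ∎
  where
  lower-shift : ∀ a k → a + k ≡ (a + (k - 1ℤ)) + 1ℤ
  lower-shift = solve-∀

G-suc² : ∀ d l k → G (suc d) (suc l) k ≡ G d (suc l) k +ℕ G (suc d) l k
G-suc² d l k = begin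
  G (suc d) (suc l) k
    ≡⟨ binomℤ-pascal-at n (+ d + k) refl (+suc-+ d k) ⟩
  binomℤ n (+ d + k) +ℕ binomℤ n ((+ d + k) + 1ℤ)
    ≡⟨ cong₂ _+ℕ_ (cong (λ m → binomℤ m (+ d + k)) (+-suc l d))
                  (cong (binomℤ n) (sym (+suc-+ d k))) ⟩
  G d (suc l) k +ℕ G (suc d) l k
    ∎
  where
  n : ℕ
  n = l +ℕ suc d

product-split : ∀ {X Y} a a' b b' → X ≡ a +ℕ a' → Y ≡ b +ℕ b' →
  X * Y +ℕ a * b ≡ (a * Y +ℕ a' * b') +ℕ X * b
product-split a a' b b' refl refl = expand a a' b b'
  where
  expand : ∀ a a' b b' → (a +ℕ a') * (b +ℕ b') +ℕ a * b
                       ≡ (a * (b +ℕ b') +ℕ a' * b') +ℕ (a +ℕ a') * b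
  expand = ℕ-Solver.solve-∀

-- The four recurrences of the closed form, one for each pair of first
-- letters; in the last two the first factor is G at -k, so the shifts of k
-- pass through a negation.
closedForm-↓⟵ : ∀ u d r l k → closedForm u (suc d) r (suc l) k
  ≡ closedForm u d r (suc l) k +ℕ closedForm u (suc d) r l k
closedForm-↓⟵ u d r l k = trans (cong (G u r (- k) *_) (G-suc² d l k))
  (*-distribˡ-+ (G u r (- k)) (G d (suc l) k) (G (suc d) l k))

closedForm-↑⟶ : ∀ u d r l k → closedForm (suc u) d (suc r) l k
  ≡ closedForm u d (suc r) l k +ℕ closedForm (suc u) d r l k
closedForm-↑⟶ u d r l k = trans (cong (_* G d l k) (G-suc² u r (- k)))
  (*-distribʳ-+ (G d l k) (G u (suc r) (- k)) (G (suc u) r (- k)))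

closedForm-↑⟵ : ∀ u d r l k → closedForm (suc u) d r (suc l) k +ℕ closedForm u d r l k
  ≡ (closedForm u d r (suc l) k +ℕ closedForm u d r l (k - 1ℤ)) +ℕ closedForm (suc u) d r l k
closedForm-↑⟵ u d r l k =
  product-split (G u r (- k)) (G u r (- (k - 1ℤ))) (G d l k) (G d l (k - 1ℤ)) first (G-sucˡ d l k)
  where
  first : G (suc u) r (- k) ≡ G u r (- k) +ℕ G u r (- (k - 1ℤ))
  first = trans (G-sucᵈ u r (- k))
    (cong (λ z → G u r (- k) +ℕ G u r z) (sym (ℤ.neg-distrib-+ k -1ℤ)))

closedForm-↓⟶ : ∀ u d r l k → closedForm u (suc d) (suc r) l k +ℕ closedForm u d r l k
  ≡ (closedForm u (suc d) r l k +ℕ closedForm u d r l (k + 1ℤ)) +ℕ closedForm u d (suc r) l k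
closedForm-↓⟶ u d r l k =
  product-split (G u r (- k)) (G u r (- (k + 1ℤ))) (G d l k) (G d l (k + 1ℤ)) first (G-sucᵈ d l k)
  where
  first : G u (suc r) (- k) ≡ G u r (- k) +ℕ G u r (- (k + 1ℤ))
  first = trans (G-sucˡ u r (- k))
    (cong (λ z → G u r (- k) +ℕ G u r z) (sym (ℤ.neg-distrib-+ k 1ℤ)))

C-above : ∀ n j → n C (n +ℕ suc j) ≡ 0
C-above n j = k>n⇒nCk≡0 (m<m+n n (s≤s z≤n))

-- With no vertical letters, or no horizontal letters, the closed form is
-- the indicator of k = 0, i.e. the count of the single empty word.
closedForm-noV : ∀ r l k → countPeak k ([] ∷ []) ≡ closedForm 0 0 r l k
closedForm-noV r l (+ zero) = refl
closedForm-noV r l +[1+ j ] = refl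
closedForm-noV r l -[1+ j ] = sym (*-zeroʳ (G 0 r +[1+ j ]))

closedForm-noH : ∀ u d k → countPeak k ([] ∷ []) ≡ closedForm u d 0 0 k
closedForm-noH u d (+ zero) =
  sym (cong₂ _*_ (trans (cong (u C_) (+-identityʳ u)) (nCn≡1 u))
                 (trans (cong (d C_) (+-identityʳ d)) (nCn≡1 d)))
closedForm-noH u d +[1+ j ] =
  sym (trans (cong (G u 0 -[1+ j ] *_) (C-above d j)) (*-zeroʳ (G u 0 -[1+ j ])))
closedForm-noH u d -[1+ j ] = sym (cong (_* G d 0 -[1+ j ]) (C-above u j))

Neutral : Letter → List Letter → Set
Neutral x w = peak (x ∷ w) ≡ peak w

up-vl-neutral : ∀ a w → Neutral up (vl a ∷ w)
up-vl-neutral ↑ w = refl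
up-vl-neutral ↓ w = refl

right-hl-neutral : ∀ b w → Neutral right (hl b ∷ w)
right-hl-neutral ⟶ w = refl
right-hl-neutral ⟵ w = refl

peak-up-left : ∀ w → peak (up ∷ left ∷ w) ≡ peak (left ∷ w) + 1ℤ
peak-up-left w = shift (+ #upLeft (left ∷ w)) (+ #rightDown (left ∷ w))
  where
  shift : ∀ a b → (1ℤ + a) - b ≡ (a - b) + 1ℤ
  shift = solve-∀

peak-right-down : ∀ w → peak (right ∷ down ∷ w) ≡ peak (down ∷ w) + -1ℤ
peak-right-down w = shift (+ #upLeft (down ∷ w)) (+ #rightDown (down ∷ w))
  where
  shift : ∀ a b → a - (1ℤ + b) ≡ (a - b) + -1ℤ
  shift = solve-∀

peak-map-hl : ∀ H → peak (map hl H) ≡ 0ℤ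
peak-map-hl [] = refl
peak-map-hl (⟵ ∷ h) = peak-map-hl h
peak-map-hl (⟶ ∷ []) = refl
peak-map-hl (⟶ ∷ b ∷ h) = trans (right-hl-neutral b (map hl h)) (peak-map-hl (b ∷ h))

peak-map-vl : ∀ V → peak (map vl V) ≡ 0ℤ
peak-map-vl [] = refl
peak-map-vl (↓ ∷ v) = peak-map-vl v
peak-map-vl (↑ ∷ []) = refl
peak-map-vl (↑ ∷ a ∷ v) = trans (up-vl-neutral a (map vl v)) (peak-map-vl (a ∷ v))

countPeak-++ : ∀ k xs ys → countPeak k (xs ++ ys) ≡ countPeak k xs +ℕ countPeak k ys
countPeak-++ k [] ys = refl
countPeak-++ k (x ∷ xs) ys with peak x ≟ k
... | yes _ = cong suc (countPeak-++ k xs ys)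
... | no _ = countPeak-++ k xs ys

countPeak-map-++ : ∀ k (f : List Letter → List Letter) xs ys →
  countPeak k (map f (xs ++ ys)) ≡ countPeak k (map f xs) +ℕ countPeak k (map f ys)
countPeak-map-++ k f xs ys = trans (cong (countPeak k) (map-++ f xs ys)) (countPeak-++ k (map f xs) _)

countPeak-shift : ∀ x c {k k'} S → k' + c ≡ k →
  All (λ w → peak (x ∷ w) ≡ peak w + c) S → countPeak k (map (x ∷_) S) ≡ countPeak k' S
countPeak-shift x c {k} {k'} [] eq [] = refl
countPeak-shift x c {k} {k'} (w ∷ S) eq (p ∷ ps) with peak (x ∷ w) ≟ k | peak w ≟ k'
... | yes _ | yes _ = cong suc (countPeak-shift x c S eq ps)
... | no _ | no _ = countPeak-shift x c S eq ps
... | yes e | no ne = ⊥-elim (ne (+-cancelʳ-ℤ c _ _ (trans (sym p) (trans e (sym eq)))))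
... | no ne | yes e = ⊥-elim (ne (trans p (trans (cong (_+ c) e) eq)))

countPeak-neutral : ∀ x {k} S → All (Neutral x) S → countPeak k (map (x ∷_) S) ≡ countPeak k S
countPeak-neutral x {k} S ns =
  countPeak-shift x 0ℤ S (ℤ.+-identityʳ k)
    (All.map (λ e → trans e (sym (ℤ.+-identityʳ _))) ns)

countPeak-peakless : ∀ w k → peak w ≡ 0ℤ → countPeak k (w ∷ []) ≡ countPeak k ([] ∷ [])
countPeak-peakless w k p with peak w ≟ k | peak [] ≟ k
... | yes _ | yes _ = refl
... | no _ | no _ = refl
... | yes e | no ne = ⊥-elim (ne (trans (sym p) e))
... | no ne | yes e = ⊥-elim (ne (trans p e))

vFirst : List VLetter → List HLetter → List (List Letter)
vFirst [] H = []
vFirst (a ∷ v) H = map (vl a ∷_) (shuffles v H)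

hFirst : List VLetter → List HLetter → List (List Letter)
hFirst V [] = []
hFirst V (b ∷ h) = map (hl b ∷_) (shuffles V h)

shuffles-splitᵛ : ∀ a v H → shuffles (a ∷ v) H ≡ vFirst (a ∷ v) H ++ hFirst (a ∷ v) H
shuffles-splitᵛ a [] [] = refl
shuffles-splitᵛ a (_ ∷ _) [] = refl
shuffles-splitᵛ a v (_ ∷ _) = refl

shuffles-splitʰ : ∀ V b h → shuffles V (b ∷ h) ≡ vFirst V (b ∷ h) ++ hFirst V (b ∷ h)
shuffles-splitʰ [] b h = refl
shuffles-splitʰ (_ ∷ _) b h = refl

up-neutral-vFirst : ∀ V H → All (Neutral up) (vFirst V H)
up-neutral-vFirst [] H = []
up-neutral-vFirst (a ∷ v) H = map⁺ (universal (up-vl-neutral a) (shuffles v H))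

right-neutral-hFirst : ∀ V H → All (Neutral right) (hFirst V H)
right-neutral-hFirst V [] = []
right-neutral-hFirst V (b ∷ h) = map⁺ (universal (right-hl-neutral b) (shuffles V h))

peakCount : List VLetter → List HLetter → ℤ → ℕ
peakCount V H k = countPeak k (shuffles V H)

-- ↓ and ← never start a peak factor, so a leading ↓ or ← is invisible.
peakCount-↓⟵ : ∀ v h k →
  peakCount (↓ ∷ v) (⟵ ∷ h) k ≡ peakCount v (⟵ ∷ h) k +ℕ peakCount (↓ ∷ v) h k
peakCount-↓⟵ v h k = trans (countPeak-++ k (map (down ∷_) S₁) (map (left ∷_) S₂))
  (cong₂ _+ℕ_ (countPeak-neutral down S₁ (universal (λ _ → refl) S₁))
              (countPeak-neutral left S₂ (universal (λ _ → refl) S₂)))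
  where
  S₁ : List (List Letter)
  S₁ = shuffles v (⟵ ∷ h)
  S₂ : List (List Letter)
  S₂ = shuffles (↓ ∷ v) h

-- A leading ↑ is followed by a vertical letter or by →, and a leading → by
-- ↑ or a horizontal letter: no peak factor is created.
peakCount-↑⟶ : ∀ v h k →
  peakCount (↑ ∷ v) (⟶ ∷ h) k ≡ peakCount v (⟶ ∷ h) k +ℕ peakCount (↑ ∷ v) h k
peakCount-↑⟶ v h k = trans (countPeak-++ k (map (up ∷_) S₁) (map (right ∷_) S₂))
  (cong₂ _+ℕ_ (countPeak-neutral up S₁ up-neutral) (countPeak-neutral right S₂ right-neutral))
  where
  S₁ : List (List Letter)
  S₁ = shuffles v (⟶ ∷ h)
  S₂ : List (List Letter)
  S₂ = shuffles (↑ ∷ v) h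
  up-neutral : All (Neutral up) S₁
  up-neutral = subst (All (Neutral up)) (sym (shuffles-splitʰ v ⟶ h))
    (++⁺ (up-neutral-vFirst v (⟶ ∷ h)) (map⁺ (universal (λ _ → refl) (shuffles v h))))
  right-neutral : All (Neutral right) S₂
  right-neutral = subst (All (Neutral right)) (sym (shuffles-splitᵛ ↑ v h))
    (++⁺ (map⁺ (universal (λ _ → refl) (shuffles v h))) (right-neutral-hFirst (↑ ∷ v) h))

-- Prepending ↑ to the shuffles of V and ←h: exactly the shuffles that start
-- with ← gain one peak.
up-before-⟵ : ∀ V h k →
  countPeak k (map (up ∷_) (shuffles V (⟵ ∷ h))) +ℕ peakCount V h k
    ≡ peakCount V (⟵ ∷ h) k +ℕ peakCount V h (k - 1ℤ)
up-before-⟵ V h k = begin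
  countPeak k (map (up ∷_) (shuffles V (⟵ ∷ h))) +ℕ countPeak k S
    ≡⟨ cong (_+ℕ countPeak k S) with-up ⟩
  (countPeak k P +ℕ countPeak (k - 1ℤ) S) +ℕ countPeak k S
    ≡⟨ xy∙z≈xz∙y (countPeak k P) _ _ ⟩
  (countPeak k P +ℕ countPeak k S) +ℕ countPeak (k - 1ℤ) S
    ≡⟨ cong (_+ℕ countPeak (k - 1ℤ) S) (sym without-up) ⟩
  peakCount V (⟵ ∷ h) k +ℕ countPeak (k - 1ℤ) S
    ∎
  where
  P : List (List Letter)
  P = vFirst V (⟵ ∷ h)
  S : List (List Letter)
  S = shuffles V h
  left-invisible : ∀ {j} → countPeak j (map (left ∷_) S) ≡ countPeak j S
  left-invisible = countPeak-neutral left S (universal (λ _ → refl) S)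
  without-up : peakCount V (⟵ ∷ h) k ≡ countPeak k P +ℕ countPeak k S
  without-up = trans (cong (countPeak k) (shuffles-splitʰ V ⟵ h))
    (trans (countPeak-++ k P _) (cong (countPeak k P +ℕ_) left-invisible))
  with-up : countPeak k (map (up ∷_) (shuffles V (⟵ ∷ h)))
          ≡ countPeak k P +ℕ countPeak (k - 1ℤ) S
  with-up = trans (cong (λ L → countPeak k (map (up ∷_) L)) (shuffles-splitʰ V ⟵ h))
    (trans (countPeak-map-++ k (up ∷_) P _)
      (cong₂ _+ℕ_ (countPeak-neutral up P (up-neutral-vFirst V (⟵ ∷ h)))
        (trans (countPeak-shift up 1ℤ _ (pred-+1 k) (map⁺ (universal peak-up-left S)))
               left-invisible)))

-- Prepending → to the shuffles of ↓V and H: exactly the shuffles that start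
-- with ↓ lose one peak.
right-before-↓ : ∀ V H k →
  countPeak k (map (right ∷_) (shuffles (↓ ∷ V) H)) +ℕ peakCount V H k
    ≡ peakCount (↓ ∷ V) H k +ℕ peakCount V H (k + 1ℤ)
right-before-↓ V H k = begin
  countPeak k (map (right ∷_) (shuffles (↓ ∷ V) H)) +ℕ countPeak k S
    ≡⟨ cong (_+ℕ countPeak k S) with-right ⟩
  (countPeak (k + 1ℤ) S +ℕ countPeak k Q) +ℕ countPeak k S
    ≡⟨ xy∙z≈zy∙x (countPeak (k + 1ℤ) S) _ _ ⟩
  (countPeak k S +ℕ countPeak k Q) +ℕ countPeak (k + 1ℤ) S
    ≡⟨ cong (_+ℕ countPeak (k + 1ℤ) S) (sym without-right) ⟩
  peakCount (↓ ∷ V) H k +ℕ countPeak (k + 1ℤ) S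
    ∎
  where
  Q : List (List Letter)
  Q = hFirst (↓ ∷ V) H
  S : List (List Letter)
  S = shuffles V H
  down-invisible : ∀ {j} → countPeak j (map (down ∷_) S) ≡ countPeak j S
  down-invisible = countPeak-neutral down S (universal (λ _ → refl) S)
  without-right : peakCount (↓ ∷ V) H k ≡ countPeak k S +ℕ countPeak k Q
  without-right = trans (cong (countPeak k) (shuffles-splitᵛ ↓ V H))
    (trans (countPeak-++ k (map (down ∷_) S) Q) (cong (_+ℕ countPeak k Q) down-invisible))
  with-right : countPeak k (map (right ∷_) (shuffles (↓ ∷ V) H))
             ≡ countPeak (k + 1ℤ) S +ℕ countPeak k Q
  with-right = trans (cong (λ L → countPeak k (map (right ∷_) L)) (shuffles-splitᵛ ↓ V H))
    (trans (countPeak-map-++ k (right ∷_) (map (down ∷_) S) Q)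
      (cong₂ _+ℕ_
        (trans (countPeak-shift right -1ℤ _ (suc-+-1 k) (map⁺ (universal peak-right-down S)))
               down-invisible)
        (countPeak-neutral right Q (right-neutral-hFirst (↓ ∷ V) H))))

peakCount-↑⟵ : ∀ v h k → peakCount (↑ ∷ v) (⟵ ∷ h) k +ℕ peakCount v h k
  ≡ (peakCount v (⟵ ∷ h) k +ℕ peakCount v h (k - 1ℤ)) +ℕ peakCount (↑ ∷ v) h k
peakCount-↑⟵ v h k = begin
  peakCount (↑ ∷ v) (⟵ ∷ h) k +ℕ peakCount v h k
    ≡⟨ cong (_+ℕ peakCount v h k) (countPeak-++ k (map (up ∷_) S₁) (map (left ∷_) S₂)) ⟩
  (countPeak k (map (up ∷_) S₁) +ℕ countPeak k (map (left ∷_) S₂)) +ℕ peakCount v h k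
    ≡⟨ cong (λ n → (countPeak k (map (up ∷_) S₁) +ℕ n) +ℕ peakCount v h k)
            (countPeak-neutral left S₂ (universal (λ _ → refl) S₂)) ⟩
  (countPeak k (map (up ∷_) S₁) +ℕ peakCount (↑ ∷ v) h k) +ℕ peakCount v h k
    ≡⟨ xy∙z≈xz∙y (countPeak k (map (up ∷_) S₁)) _ _ ⟩
  (countPeak k (map (up ∷_) S₁) +ℕ peakCount v h k) +ℕ peakCount (↑ ∷ v) h k
    ≡⟨ cong (_+ℕ peakCount (↑ ∷ v) h k) (up-before-⟵ v h k) ⟩
  (peakCount v (⟵ ∷ h) k +ℕ peakCount v h (k - 1ℤ)) +ℕ peakCount (↑ ∷ v) h k
    ∎
  where
  S₁ : List (List Letter)
  S₁ = shuffles v (⟵ ∷ h)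
  S₂ : List (List Letter)
  S₂ = shuffles (↑ ∷ v) h

peakCount-↓⟶ : ∀ v h k → peakCount (↓ ∷ v) (⟶ ∷ h) k +ℕ peakCount v h k
  ≡ (peakCount (↓ ∷ v) h k +ℕ peakCount v h (k + 1ℤ)) +ℕ peakCount v (⟶ ∷ h) k
peakCount-↓⟶ v h k = begin
  peakCount (↓ ∷ v) (⟶ ∷ h) k +ℕ peakCount v h k
    ≡⟨ cong (_+ℕ peakCount v h k) (countPeak-++ k (map (down ∷_) S₁) (map (right ∷_) S₂)) ⟩
  (countPeak k (map (down ∷_) S₁) +ℕ countPeak k (map (right ∷_) S₂)) +ℕ peakCount v h k
    ≡⟨ cong (λ n → (n +ℕ countPeak k (map (right ∷_) S₂)) +ℕ peakCount v h k)
            (countPeak-neutral down S₁ (universal (λ _ → refl) S₁)) ⟩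
  (peakCount v (⟶ ∷ h) k +ℕ countPeak k (map (right ∷_) S₂)) +ℕ peakCount v h k
    ≡⟨ xy∙z≈yz∙x (peakCount v (⟶ ∷ h) k) _ _ ⟩
  (countPeak k (map (right ∷_) S₂) +ℕ peakCount v h k) +ℕ peakCount v (⟶ ∷ h) k
    ≡⟨ cong (_+ℕ peakCount v (⟶ ∷ h) k) (right-before-↓ v h k) ⟩
  (peakCount (↓ ∷ v) h k +ℕ peakCount v h (k + 1ℤ)) +ℕ peakCount v (⟶ ∷ h) k
    ∎
  where
  S₁ : List (List Letter)
  S₁ = shuffles v (⟶ ∷ h)
  S₂ : List (List Letter)
  S₂ = shuffles (↓ ∷ v) h

agree-additive : ∀ {N N₁ N₂ F F₁ F₂ : ℕ} →
  N ≡ N₁ +ℕ N₂ → F ≡ F₁ +ℕ F₂ → N₁ ≡ F₁ → N₂ ≡ F₂ → N ≡ F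
agree-additive eqN eqF refl refl = trans eqN (sym eqF)

agree-cancelling : ∀ {N n N₁ N₂ N₃ F f F₁ F₂ F₃ : ℕ} →
  N +ℕ n ≡ (N₁ +ℕ N₂) +ℕ N₃ → F +ℕ f ≡ (F₁ +ℕ F₂) +ℕ F₃ →
  n ≡ f → N₁ ≡ F₁ → N₂ ≡ F₂ → N₃ ≡ F₃ → N ≡ F
agree-cancelling {N} {n} {F = F} eqN eqF refl refl refl refl =
  +-cancelʳ-≡ n N F (trans eqN (sym eqF))

theorem2p16 : (V : List VLetter) (H : List HLetter) (k : ℤ) →
    countPeak k (shuffles V H)
      ≡ binomℤ (countH ⟶ H +ℕ countV ↑ V) (+ countV ↑ V - k)
          * binomℤ (countH ⟵ H +ℕ countV ↓ V) (+ countV ↓ V + k)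
theorem2p16 [] H k =
  trans (countPeak-peakless (map hl H) k (peak-map-hl H))
        (closedForm-noV (countH ⟶ H) (countH ⟵ H) k)
theorem2p16 (a ∷ v) [] k =
  trans (countPeak-peakless (map vl (a ∷ v)) k (peak-map-vl (a ∷ v)))
        (closedForm-noH (countV ↑ (a ∷ v)) (countV ↓ (a ∷ v)) k)
theorem2p16 (↓ ∷ v) (⟵ ∷ h) k =
  agree-additive (peakCount-↓⟵ v h k)
    (closedForm-↓⟵ (countV ↑ v) (countV ↓ v) (countH ⟶ h) (countH ⟵ h) k)
    (theorem2p16 v (⟵ ∷ h) k) (theorem2p16 (↓ ∷ v) h k)
theorem2p16 (↑ ∷ v) (⟶ ∷ h) k =
  agree-additive (peakCount-↑⟶ v h k)
    (closedForm-↑⟶ (countV ↑ v) (countV ↓ v) (countH ⟶ h) (countH ⟵ h) k)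
    (theorem2p16 v (⟶ ∷ h) k) (theorem2p16 (↑ ∷ v) h k)
theorem2p16 (↑ ∷ v) (⟵ ∷ h) k =
  agree-cancelling (peakCount-↑⟵ v h k)
    (closedForm-↑⟵ (countV ↑ v) (countV ↓ v) (countH ⟶ h) (countH ⟵ h) k)
    (theorem2p16 v h k)
    (theorem2p16 v (⟵ ∷ h) k) (theorem2p16 v h (k - 1ℤ)) (theorem2p16 (↑ ∷ v) h k)
theorem2p16 (↓ ∷ v) (⟶ ∷ h) k =
  agree-cancelling (peakCount-↓⟶ v h k)
    (closedForm-↓⟶ (countV ↑ v) (countV ↓ v) (countH ⟶ h) (countH ⟵ h) k)
    (theorem2p16 v h k)
    (theorem2p16 (↓ ∷ v) h k) (theorem2p16 v h (k + 1ℤ)) (theorem2p16 v (⟶ ∷ h) k)
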